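{- For $r\ge 3$, $a_r = a_{r-1} + 4a_{r-3}$.
   Context: The Stern sequence $(s(n))_{n\ge0}$ is defined by $s(0)=0$, $s(1)=1$, $s(2n)=s(n)$, $s(2n+1)=s(n)+s(n+1)$. For $r\ge0$, let $a_r=|\{n: 2^r\le n<2^{r+1},\ 3\mid s(n)\}|$. -}

module Defs where

open import Data.Nat using (ℕ; zero; suc; _+_; _*_; _^_; _%_; ⌊_/2⌋)
open import Data.Nat.Divisibility using (_∣_; _∣?_)
open import Data.List using (List; length; filter; upTo; map)

-- Auxiliary: sternAux fuel n computes s(n) provided fuel ≥ n.
-- Recursion: s(0)=0, s(1)=1, s(2m)=s(m), s(2m+1)=s(m)+s(m+1).
sternAux : ℕ → ℕ → ℕ
sternAux zero    _ = 0
sternAux (suc f) zero = 0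
sternAux (suc f) (suc zero) = 1
sternAux (suc f) n@(suc (suc _)) with n % 2
... | zero  = sternAux f ⌊ n /2⌋
... | suc _ = sternAux f ⌊ n /2⌋ + sternAux f (suc ⌊ n /2⌋)

stern : ℕ → ℕ
stern n = sternAux n n

a : ℕ → ℕ
a r = length (filter (λ n → 3 ∣? stern n) (map (λ k → 2 ^ r + k) (upTo (2 ^ r))))

{-# OPTIONS --safe #-}
-- Reduce the pair (s(n), s(n+1)) mod 3 to a state in (ℤ/3)²: the states of 2n and 2n+1 are
-- L(x,y) = (x, x+y) and R(x,y) = (x+y, y) applied to the state of n. So summing a weight over the
-- block [2ʳm, 2ʳ(m+1)) is summing it over the depth-r descendants of the state of m in the binary
-- tree generated by L and R, an operation linear in the weight. The weight counting zero
-- coordinates satisfies, at each of the nine states, "sum over depth-3 descendants = sum over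
-- depth-2 descendants + 4 × itself"; summed over the depth-r descendants of the root (1,1) this is
-- the recurrence for 2aᵣ, since the symmetry L∘swap = swap∘R makes the second coordinates
-- contribute aᵣ as well. (The first-coordinate weight alone satisfies no such pointwise identity.)
module Submission where

open import Defs
open import Data.Nat using (ℕ; _+_; _*_; _≤_; _∸_)
open import Relation.Binary.PropositionalEquality using (_≡_)

open import Data.Bool using (true; false; if_then_else_)
open import Data.Fin using (Fin; zero; suc; toℕ; fromℕ<)
open import Data.Fin.Properties using (toℕ-injective; toℕ-fromℕ<)
open import Data.List using ([]; _∷_; length; filter; map; upTo; applyUpTo)
open import Data.Nat.ListAction using (sum)
open import Data.List.Properties using (map-upTo; map-applyUpTo)
open import Data.Nat using (zero; suc; _^_; _%_; _<_; _≡ᵇ_; ⌊_/2⌋; s≤s)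
open import Data.Nat.DivMod using (_mod_; m%n<n; %-distribˡ-+; m*n%n≡0; [m+kn]%n≡m%n)
open import Data.Nat.Divisibility using (_∣?_)
open import Data.Nat.Properties
  using (+-comm; +-assoc; +-identityʳ; *-identityˡ; *-identityʳ; *-distribˡ-+; *-cancelˡ-≡;
         ≤-refl; ≤-trans; n≤1+n; m≤m*n; ⌊n/2⌋≤n; ⌊n/2⌋<n; +-commutativeSemigroup)
open import Data.Nat.Tactic.RingSolver using (solve-∀)
open import Data.Product using (_×_; _,_; proj₁; swap)
open import Function using (_∘_)
open import Relation.Nullary using (does)
open import Relation.Unary using (Pred; Decidable)
open import Relation.Binary.PropositionalEquality using (refl; sym; trans; cong; cong₂; module ≡-Reasoning)
open import Algebra.Properties.CommutativeSemigroup +-commutativeSemigroup using (interchange)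

open ≡-Reasoning

sternAux-fuel : ∀ {f g} n → n ≤ f → n ≤ g → sternAux f n ≡ sternAux g n
sternAux-fuel {zero}  {zero}  zero _ _ = refl
sternAux-fuel {zero}  {suc _} zero _ _ = refl
sternAux-fuel {suc _} {zero}  zero _ _ = refl
sternAux-fuel {suc _} {suc _} zero _ _ = refl
sternAux-fuel {suc _} {suc _} 1 _ _ = refl
sternAux-fuel {suc (suc _)} {suc (suc _)} 2 _ _ = refl
sternAux-fuel {suc f} {suc g} (suc (suc (suc k))) (s≤s n≤f) (s≤s n≤g) with suc k % 2
... | zero  = sternAux-fuel (suc ⌊ suc k /2⌋) (≤-trans h n≤f) (≤-trans h n≤g)
  where h = s≤s (⌊n/2⌋≤n (suc k))
... | suc _ = cong₂ _+_ (sternAux-fuel (suc ⌊ suc k /2⌋) (≤-trans h₁ n≤f) (≤-trans h₁ n≤g))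
                        (sternAux-fuel (suc (suc ⌊ suc k /2⌋)) (≤-trans h₂ n≤f) (≤-trans h₂ n≤g))
  where h₁ = s≤s (⌊n/2⌋≤n (suc k))
        h₂ = s≤s (⌊n/2⌋<n k)

sternAux≡stern : ∀ {f} n → n ≤ f → sternAux f n ≡ stern n
sternAux≡stern n n≤f = sternAux-fuel n n≤f ≤-refl

⌊n*2/2⌋≡n : ∀ n → ⌊ n * 2 /2⌋ ≡ n
⌊n*2/2⌋≡n zero    = refl
⌊n*2/2⌋≡n (suc n) = cong suc (⌊n*2/2⌋≡n n)

⌊1+n*2/2⌋≡n : ∀ n → ⌊ suc (n * 2) /2⌋ ≡ n
⌊1+n*2/2⌋≡n zero    = refl
⌊1+n*2/2⌋≡n (suc n) = cong suc (⌊1+n*2/2⌋≡n n)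

n*2%2≡0 : ∀ n → n * 2 % 2 ≡ 0
n*2%2≡0 n = m*n%n≡0 n 2

1+n*2%2≡1 : ∀ n → suc (n * 2) % 2 ≡ 1
1+n*2%2≡1 n = [m+kn]%n≡m%n 1 n 2

sternAux-double : ∀ f n → sternAux (suc f) (suc n * 2) ≡ sternAux f (suc n)
sternAux-double f n rewrite n*2%2≡0 n | ⌊n*2/2⌋≡n n = refl

sternAux-suc-double : ∀ f n →
  sternAux (suc f) (suc (suc n * 2)) ≡ sternAux f (suc n) + sternAux f (suc (suc n))
sternAux-suc-double f n rewrite 1+n*2%2≡1 n | ⌊1+n*2/2⌋≡n n = refl

stern-double : ∀ n → stern (n * 2) ≡ stern n
stern-double zero    = refl
stern-double (suc n) = trans (sternAux-double (suc (n * 2)) n)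
                             (sternAux≡stern (suc n) (s≤s (m≤m*n n 2)))

stern-suc-double : ∀ n → stern (suc (n * 2)) ≡ stern n + stern (suc n)
stern-suc-double zero    = refl
stern-suc-double (suc n) = trans (sternAux-suc-double (suc (suc (n * 2))) n)
  (cong₂ _+_ (sternAux≡stern (suc n) (s≤s (≤-trans (m≤m*n n 2) (n≤1+n _))))
             (sternAux≡stern (suc (suc n)) (s≤s (s≤s (m≤m*n n 2)))))

infixl 6 _+₃_

_+₃_ : Fin 3 → Fin 3 → Fin 3
x +₃ y = (toℕ x + toℕ y) mod 3

+₃-comm : ∀ x y → x +₃ y ≡ y +₃ x
+₃-comm x y = cong (_mod 3) (+-comm (toℕ x) (toℕ y))

toℕ-mod : ∀ n → toℕ (n mod 3) ≡ n % 3
toℕ-mod n = toℕ-fromℕ< (m%n<n n 3)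

mod-distrib-+ : ∀ m n → (m + n) mod 3 ≡ m mod 3 +₃ n mod 3
mod-distrib-+ m n = toℕ-injective (begin
  toℕ ((m + n) mod 3)                  ≡⟨ toℕ-mod (m + n) ⟩
  (m + n) % 3                          ≡⟨ %-distribˡ-+ m n 3 ⟩
  (m % 3 + n % 3) % 3                  ≡⟨ cong₂ (λ x y → (x + y) % 3) (toℕ-mod m) (toℕ-mod n) ⟨
  (toℕ (m mod 3) + toℕ (n mod 3)) % 3  ≡⟨ toℕ-mod (toℕ (m mod 3) + toℕ (n mod 3)) ⟨
  toℕ (m mod 3 +₃ n mod 3)             ∎)

State : Set
State = Fin 3 × Fin 3

left right : State → State
left  (x , y) = x , x +₃ y
right (x , y) = x +₃ y , y

swap-left : ∀ p → swap (left p) ≡ right (swap p)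
swap-left (x , y) = cong (_, x) (+₃-comm x y)

swap-right : ∀ p → swap (right p) ≡ left (swap p)
swap-right (x , y) = cong (y ,_) (+₃-comm x y)

state : ℕ → State
state n = stern n mod 3 , stern (suc n) mod 3

state-double : ∀ n → state (n * 2) ≡ left (state n)
state-double n = cong₂ _,_
  (cong (_mod 3) (stern-double n))
  (trans (cong (_mod 3) (stern-suc-double n)) (mod-distrib-+ (stern n) (stern (suc n))))

state-suc-double : ∀ n → state (suc (n * 2)) ≡ right (state n)
state-suc-double n = cong₂ _,_
  (trans (cong (_mod 3) (stern-suc-double n)) (mod-distrib-+ (stern n) (stern (suc n))))
  (cong (_mod 3) (stern-double (suc n)))

descendantSum : ℕ → (State → ℕ) → State → ℕ
descendantSum zero    G p = G p
descendantSum (suc r) G p = descendantSum r G (left p) + descendantSum r G (right p)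

descendantSum-cong : ∀ r {F G : State → ℕ} → (∀ p → F p ≡ G p) →
                     ∀ p → descendantSum r F p ≡ descendantSum r G p
descendantSum-cong zero    F≗G p = F≗G p
descendantSum-cong (suc r) F≗G p =
  cong₂ _+_ (descendantSum-cong r F≗G (left p)) (descendantSum-cong r F≗G (right p))

descendantSum-homo-+ : ∀ r (F G : State → ℕ) p →
  descendantSum r (λ q → F q + G q) p ≡ descendantSum r F p + descendantSum r G p
descendantSum-homo-+ zero    F G p = refl
descendantSum-homo-+ (suc r) F G p = begin
  descendantSum r (λ q → F q + G q) (left p) + descendantSum r (λ q → F q + G q) (right p)
    ≡⟨ cong₂ _+_ (descendantSum-homo-+ r F G (left p)) (descendantSum-homo-+ r F G (right p)) ⟩
  (descendantSum r F (left p) + descendantSum r G (left p)) +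
  (descendantSum r F (right p) + descendantSum r G (right p))
    ≡⟨ interchange (descendantSum r F (left p)) _ _ _ ⟩
  descendantSum (suc r) F p + descendantSum (suc r) G p ∎

descendantSum-homo-* : ∀ r c (F : State → ℕ) p →
  descendantSum r (λ q → c * F q) p ≡ c * descendantSum r F p
descendantSum-homo-* zero    c F p = refl
descendantSum-homo-* (suc r) c F p = trans
  (cong₂ _+_ (descendantSum-homo-* r c F (left p)) (descendantSum-homo-* r c F (right p)))
  (sym (*-distribˡ-+ c _ _))

descendantSum-+ : ∀ r k (G : State → ℕ) p →
  descendantSum (r + k) G p ≡ descendantSum r (descendantSum k G) p
descendantSum-+ zero    k G p = refl
descendantSum-+ (suc r) k G p =
  cong₂ _+_ (descendantSum-+ r k G (left p)) (descendantSum-+ r k G (right p))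

descendantSum-swap : ∀ r (G : State → ℕ) p →
  descendantSum r (G ∘ swap) p ≡ descendantSum r G (swap p)
descendantSum-swap zero    G p = refl
descendantSum-swap (suc r) G p = begin
  descendantSum r (G ∘ swap) (left p) + descendantSum r (G ∘ swap) (right p)
    ≡⟨ cong₂ _+_ (descendantSum-swap r G (left p)) (descendantSum-swap r G (right p)) ⟩
  descendantSum r G (swap (left p)) + descendantSum r G (swap (right p))
    ≡⟨ cong₂ _+_ (cong (descendantSum r G) (swap-left p)) (cong (descendantSum r G) (swap-right p)) ⟩
  descendantSum r G (right (swap p)) + descendantSum r G (left (swap p))
    ≡⟨ +-comm (descendantSum r G (right (swap p))) _ ⟩
  descendantSum (suc r) G (swap p) ∎

applyUpTo-cong : ∀ {a} {A : Set a} {f g : ℕ → A} → (∀ k → f k ≡ g k) →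
                 ∀ n → applyUpTo f n ≡ applyUpTo g n
applyUpTo-cong f≗g zero    = refl
applyUpTo-cong f≗g (suc n) = cong₂ _∷_ (f≗g 0) (applyUpTo-cong (f≗g ∘ suc) n)

sum-applyUpTo-+ : ∀ (f : ℕ → ℕ) m n →
  sum (applyUpTo f (m + n)) ≡ sum (applyUpTo f m) + sum (applyUpTo (λ k → f (m + k)) n)
sum-applyUpTo-+ f zero    n = refl
sum-applyUpTo-+ f (suc m) n = trans
  (cong (f 0 +_) (sum-applyUpTo-+ (f ∘ suc) m n))
  (sym (+-assoc (f 0) _ _))

descendantSum-state : ∀ r m (G : State → ℕ) →
  descendantSum r G (state m) ≡ sum (applyUpTo (λ k → G (state (2 ^ r * m + k))) (2 ^ r))
descendantSum-state zero    m G =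
  sym (trans (+-identityʳ _) (cong (G ∘ state) (trans (+-identityʳ _) (*-identityˡ m))))
descendantSum-state (suc r) m G = begin
  descendantSum r G (left (state m)) + descendantSum r G (right (state m))
    ≡⟨ cong₂ _+_ (cong (descendantSum r G) (state-double m))
                 (cong (descendantSum r G) (state-suc-double m)) ⟨
  descendantSum r G (state (m * 2)) + descendantSum r G (state (suc (m * 2)))
    ≡⟨ cong₂ _+_ (descendantSum-state r (m * 2) G) (descendantSum-state r (suc (m * 2)) G) ⟩
  sum (applyUpTo (λ k → G (state (N * (m * 2) + k))) N) +
  sum (applyUpTo (λ k → G (state (N * suc (m * 2) + k))) N)
    ≡⟨ cong₂ _+_ (cong sum (applyUpTo-cong (cong (G ∘ state) ∘ block-double N m) N))
                 (cong sum (applyUpTo-cong (cong (G ∘ state) ∘ block-suc-double N m) N)) ⟩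
  sum (applyUpTo f N) + sum (applyUpTo (λ k → f (N + k)) N)
    ≡⟨ sum-applyUpTo-+ f N N ⟨
  sum (applyUpTo f (N + N))
    ≡⟨ cong (λ n → sum (applyUpTo f (N + n))) (+-identityʳ N) ⟨
  sum (applyUpTo f (2 ^ suc r)) ∎
  where
  N : ℕ
  N = 2 ^ r
  f : ℕ → ℕ
  f k = G (state (2 * N * m + k))
  block-double : ∀ x y z → x * (y * 2) + z ≡ 2 * x * y + z
  block-double = solve-∀
  block-suc-double : ∀ x y z → x * suc (y * 2) + z ≡ 2 * x * y + (x + z)
  block-suc-double = solve-∀

length-filter : ∀ {a p} {A : Set a} {P : Pred A p} (P? : Decidable P) xs →
  length (filter P? xs) ≡ sum (map (λ x → if does (P? x) then 1 else 0) xs)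
length-filter P? []       = refl
length-filter P? (x ∷ xs) with does (P? x)
... | true  = cong suc (length-filter P? xs)
... | false = length-filter P? xs

isZero : Fin 3 → ℕ
isZero zero    = 1
isZero (suc _) = 0

-- does (3 ∣? n) unfolds to n % 3 ≡ᵇ 0.
isZero-mod : ∀ n → isZero (n mod 3) ≡ (if does (3 ∣? n) then 1 else 0)
isZero-mod n = isZero-fromℕ< (m%n<n n 3)
  where
  isZero-fromℕ< : ∀ {k} (k<3 : k < 3) → isZero (fromℕ< k<3) ≡ (if k ≡ᵇ 0 then 1 else 0)
  isZero-fromℕ< {zero}  _ = refl
  isZero-fromℕ< {suc _} _ = refl

firstZero : State → ℕ
firstZero = isZero ∘ proj₁

zeros : State → ℕ
zeros p = firstZero p + firstZero (swap p)

a≡descendantSum-firstZero : ∀ r → a r ≡ descendantSum r firstZero (state 1)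
a≡descendantSum-firstZero r = begin
  a r
    ≡⟨ length-filter (λ n → 3 ∣? stern n) (map (N +_) (upTo N)) ⟩
  sum (map indicator (map (N +_) (upTo N)))
    ≡⟨ cong (sum ∘ map indicator) (map-upTo (N +_) N) ⟩
  sum (map indicator (applyUpTo (N +_) N))
    ≡⟨ cong sum (map-applyUpTo (N +_) indicator N) ⟩
  sum (applyUpTo (λ k → indicator (N + k)) N)
    ≡⟨ cong sum (applyUpTo-cong (λ k → trans (sym (isZero-mod (stern (N + k))))
                                             (cong (firstZero ∘ state ∘ (_+ k)) (sym (*-identityʳ N)))) N) ⟩
  sum (applyUpTo (λ k → firstZero (state (N * 1 + k))) N)
    ≡⟨ descendantSum-state r 1 firstZero ⟨
  descendantSum r firstZero (state 1) ∎
  where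
  N : ℕ
  N = 2 ^ r
  indicator : ℕ → ℕ
  indicator n = if does (3 ∣? stern n) then 1 else 0

twice-a≡descendantSum-zeros : ∀ r → 2 * a r ≡ descendantSum r zeros (state 1)
twice-a≡descendantSum-zeros r = sym (begin
  descendantSum r zeros (state 1)
    ≡⟨ descendantSum-homo-+ r firstZero (firstZero ∘ swap) (state 1) ⟩
  descendantSum r firstZero (state 1) + descendantSum r (firstZero ∘ swap) (state 1)
    ≡⟨ cong (descendantSum r firstZero (state 1) +_) (descendantSum-swap r firstZero (state 1)) ⟩
  descendantSum r firstZero (state 1) + descendantSum r firstZero (state 1)
    ≡⟨ cong₂ _+_ (a≡descendantSum-firstZero r) (a≡descendantSum-firstZero r) ⟨
  a r + a r
    ≡⟨ cong (a r +_) (+-identityʳ (a r)) ⟨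
  2 * a r ∎)

zeros-recurrence : ∀ p → descendantSum 3 zeros p ≡ descendantSum 2 zeros p + 4 * zeros p
zeros-recurrence (zero , zero)             = refl
zeros-recurrence (zero , suc zero)         = refl
zeros-recurrence (zero , suc (suc zero))   = refl
zeros-recurrence (suc zero , zero)           = refl
zeros-recurrence (suc zero , suc zero)       = refl
zeros-recurrence (suc zero , suc (suc zero)) = refl
zeros-recurrence (suc (suc zero) , zero)           = refl
zeros-recurrence (suc (suc zero) , suc zero)       = refl
zeros-recurrence (suc (suc zero) , suc (suc zero)) = refl

lemma5p2 : (r : ℕ) → 3 ≤ r → a r ≡ a (r ∸ 1) + 4 * a (r ∸ 3)
lemma5p2 1 (s≤s ())
lemma5p2 2 (s≤s (s≤s ()))
lemma5p2 (suc (suc (suc q))) _ = *-cancelˡ-≡ _ _ 2 (begin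
  2 * a (3 + q)
    ≡⟨ twice-a≡descendantSum-zeros (3 + q) ⟩
  descendantSum (3 + q) zeros root
    ≡⟨ splitDepth 3 ⟩
  descendantSum q (descendantSum 3 zeros) root
    ≡⟨ descendantSum-cong q zeros-recurrence root ⟩
  descendantSum q (λ p → descendantSum 2 zeros p + 4 * zeros p) root
    ≡⟨ descendantSum-homo-+ q (descendantSum 2 zeros) (λ p → 4 * zeros p) root ⟩
  descendantSum q (descendantSum 2 zeros) root + descendantSum q (λ p → 4 * zeros p) root
    ≡⟨ cong₂ _+_ (sym (splitDepth 2)) (descendantSum-homo-* q 4 zeros root) ⟩
  descendantSum (2 + q) zeros root + 4 * descendantSum q zeros root
    ≡⟨ cong₂ (λ x y → x + 4 * y) (twice-a≡descendantSum-zeros (2 + q)) (twice-a≡descendantSum-zeros q) ⟨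
  2 * a (2 + q) + 4 * (2 * a q)
    ≡⟨ factor-2 (a (2 + q)) (a q) ⟩
  2 * (a (2 + q) + 4 * a q) ∎)
  where
  root : State
  root = state 1
  splitDepth : ∀ k → descendantSum (k + q) zeros root ≡ descendantSum q (descendantSum k zeros) root
  splitDepth k = trans (cong (λ d → descendantSum d zeros root) (+-comm k q))
                       (descendantSum-+ q k zeros root)
  factor-2 : ∀ x y → 2 * x + 4 * (2 * y) ≡ 2 * (x + 4 * y)
  factor-2 = solve-∀
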